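{- Let $G$ be a graph and $B\subseteq V(G)$. Then $B$ is a skew zero forcing set for $G$ if and only if $B$ is a lazy burning set for the open neighborhood hypergraph $\mathcal{N}(G)$. In particular, $z_0(G)=b_L(\mathcal{N}(G))$.
   Context: Graphs are finite and simple. Skew zero forcing on $G$: an initial set of vertices is black, the rest white; repeatedly, any vertex $u$ (black or white) with exactly one white neighbor $w$ turns $w$ black. A skew zero forcing set is an initial black set from which all vertices eventually become black; $z_0(G)$ is the minimum size of one. The open neighborhood hypergraph $\mathcal{N}(G)$ has vertex set $V(G)$ and hyperedges $N_G(v)$ (open neighborhoods) for $v\in V(G)$. Lazy burning on a hypergraph $H$: a set $B\subseteq V(H)$ is burned initially; in each subsequent round every unburned vertex $v$ for which some hyperedge $h\ni v$ has $h\setminus\{v\}$ entirely burned becomes burned. $B$ is a lazy burning set if eventually all vertices burn; $b_L(H)$ is the minimum size of one. -}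

module Defs where

open import Level using (0ℓ)
open import Data.Nat using (ℕ; zero; suc; _≤_)
open import Data.Fin using (Fin)
open import Data.Fin.Subset using (Subset; _∈_; _∉_; ∣_∣)
open import Data.Product using (Σ; ∃; ∃-syntax; _×_; _,_)
open import Data.Sum using (_⊎_)
open import Relation.Nullary using (¬_; Dec)
open import Relation.Binary.PropositionalEquality using (_≡_; _≢_)

record Graph (n : ℕ) : Set₁ where
  field
    Adj     : Fin n → Fin n → Set
    adj?    : ∀ u v → Dec (Adj u v)
    sym     : ∀ {u v} → Adj u v → Adj v u
    irrefl  : ∀ {u} → ¬ Adj u u

record Hypergraph (n : ℕ) : Set₁ where
  field
    m   : ℕ
    Mem : Fin m → Fin n → Set

N : ∀ {n} → Graph n → Hypergraph n
N {n} G = record { m = n ; Mem = λ v x → Graph.Adj G v x }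

-- In a round, a white vertex w turns black if some vertex u (any colour)
-- has w as its unique white neighbour.

Black : ∀ {n} → Graph n → Subset n → ℕ → Fin n → Set
Black G B zero    v = v ∈ B
Black G B (suc k) w =
  Black G B k w ⊎
  (¬ Black G B k w ×
   ∃[ u ] (Graph.Adj G u w ×
           (∀ x → Graph.Adj G u x → x ≢ w → Black G B k x)))

IsSkewZeroForcingSet : ∀ {n} → Graph n → Subset n → Set
IsSkewZeroForcingSet G B = ∀ v → ∃[ k ] Black G B k v

Burned : ∀ {n} → Hypergraph n → Subset n → ℕ → Fin n → Set
Burned H B zero    v = v ∈ B
Burned H B (suc k) v =
  Burned H B k v ⊎
  (¬ Burned H B k v ×
   ∃[ h ] (Hypergraph.Mem H h v ×
           (∀ x → Hypergraph.Mem H h x → x ≢ v → Burned H B k x)))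

IsLazyBurningSet : ∀ {n} → Hypergraph n → Subset n → Set
IsLazyBurningSet H B = ∀ v → ∃[ k ] Burned H B k v

IsZ0 : ∀ {n} → Graph n → ℕ → Set
IsZ0 G k = (∃[ B ] (IsSkewZeroForcingSet G B × ∣ B ∣ ≡ k)) ×
           (∀ B → IsSkewZeroForcingSet G B → k ≤ ∣ B ∣)

IsBL : ∀ {n} → Hypergraph n → ℕ → Set
IsBL H k = (∃[ B ] (IsLazyBurningSet H B × ∣ B ∣ ≡ k)) ×
           (∀ B → IsLazyBurningSet H B → k ≤ ∣ B ∣)

-- Under the open neighbourhood hypergraph, the hyperedge N(u) contains w exactly
-- when u is adjacent to w, so "N(u) ∖ {w} is burned" is literally "w is the only
-- white neighbour of u". Hence the two processes coincide round by round, the two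
-- families of sets coincide, and so do their minimum sizes.
module Submission where

open import Defs
open import Data.Nat using (ℕ; zero; suc; _≤_)
open import Data.Fin.Subset using (Subset; ∣_∣)
open import Data.Product using (∃-syntax; _×_; _,_; map₂)
open import Function.Bundles using (_⇔_; mk⇔; Equivalence)
open import Function.Construct.Symmetry using (⇔-sym)
open import Relation.Binary.PropositionalEquality using (_≡_; refl; sym; subst)

Black≡Burned : ∀ {n} (G : Graph n) (B : Subset n) (k : ℕ) →
               Black G B k ≡ Burned (N G) B k
Black≡Burned G B zero = refl
Black≡Burned G B (suc k) rewrite Black≡Burned G B k = refl

skewZeroForcing⇔lazyBurning : ∀ {n} (G : Graph n) (B : Subset n) →
                              IsSkewZeroForcingSet G B ⇔ IsLazyBurningSet (N G) B
skewZeroForcing⇔lazyBurning G B = mk⇔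
  (λ forces v → map₂ (λ {k} → subst (λ P → P v) (Black≡Burned G B k)) (forces v))
  (λ burns v → map₂ (λ {k} → subst (λ P → P v) (sym (Black≡Burned G B k))) (burns v))

-- IsZ0 G and IsBL H unfold to this for P = IsSkewZeroForcingSet G, IsLazyBurningSet H.
IsMinimumSize : ∀ {n} → (Subset n → Set) → ℕ → Set
IsMinimumSize P k = (∃[ B ] (P B × ∣ B ∣ ≡ k)) × (∀ B → P B → k ≤ ∣ B ∣)

IsMinimumSize-cong : ∀ {n} {P Q : Subset n → Set} → (∀ B → P B ⇔ Q B) →
                     ∀ k → IsMinimumSize P k ⇔ IsMinimumSize Q k
IsMinimumSize-cong {n} P⇔Q k = mk⇔ (transport P⇔Q) (transport (λ B → ⇔-sym (P⇔Q B)))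
  where
  open Equivalence

  transport : ∀ {R S : Subset n → Set} → (∀ B → R B ⇔ S B) →
              IsMinimumSize R k → IsMinimumSize S k
  transport R⇔S ((B , RB , size) , minimal) =
    (B , to (R⇔S B) RB , size) , λ B′ SB′ → minimal B′ (from (R⇔S B′) SB′)

theorem4p3 : ∀ {n} (G : Graph n) →
    (∀ (B : Subset n) → IsSkewZeroForcingSet G B ⇔ IsLazyBurningSet (N G) B) ×
    (∀ (k : ℕ) → IsZ0 G k ⇔ IsBL (N G) k)
theorem4p3 G = skewZeroForcing⇔lazyBurning G , IsMinimumSize-cong (skewZeroForcing⇔lazyBurning G)
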